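{- For integers $n\ge k\ge 1$, \[ \eta_2(N_{n,k})=S_{n+2,k}^T+S_{n+2,k+1}^{[2]}. \]
   Context: Multiple zeta values: for positive integers $a_1,\dots,a_k$ with $a_1\ge2$, $\zeta(a_1,\dots,a_k)=\sum_{n_1>\dots>n_k\ge1}n_1^{ -a_1}\cdots n_k^{ -a_k}$; its weight is $a_1+\dots+a_k$ and depth $k$. For $n\ge2$, $1\le k\le n-1$: $S_{n,k}$ is the sum of all multiple zeta values of weight $n$ and depth $k$; $S^{[2]}_{n,k}=\sum_{2+a_2+\dots+a_k=n}\zeta(2,a_2,\dots,a_k)$ (sum of those with first argument $2$); $S^T_{n,k}=S_{n,k}-S^{[2]}_{n,k}$. For a composition (tuple of positive integers) $I=(i_1,\dots,i_j)$, $M_I(1,\frac12,\dots,\frac1m)=\sum_{1\le m_1<\dots<m_j\le m}m_1^{ -i_1}\cdots m_j^{ -i_j}$; $N_{n,k}=\sum M_I$ over all compositions $I$ of $n$ with exactly $k$ parts, so $N_{n,k}(1,\dots,\frac1m)$ is defined by linearity. $\eta_2(u)=\sum_{m\ge1}\frac{u(1,\frac12,\dots,\frac1m)}{m^2}$. -}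

module Defs where

open import Data.Nat using (ℕ; zero; suc; _∸_; _<ᵇ_)
open import Data.Bool using (Bool; true; false; if_then_else_)
open import Data.List using (List; []; _∷_; map; concatMap; upTo)
open import Data.Integer using (+_)
open import Data.Rational using (ℚ; 0ℚ; 1ℚ; _+_; _*_; _-_; _/_)

-- (1/t)^a as a rational, for t ≥ 1 (value 0 at t = 0, never used)
invPow : ℕ → ℕ → ℚ
invPow zero    a       = 0ℚ
invPow (suc j) zero    = 1ℚ
invPow (suc j) (suc a) = (+ 1 / suc j) * invPow (suc j) a

sumBetween : ℕ → ℕ → (ℕ → ℚ) → ℚ
sumBetween lo zero    f = 0ℚ
sumBetween lo (suc m) f =
  sumBetween lo m f + (if lo <ᵇ suc m then f (suc m) else 0ℚ)

comps : ℕ → ℕ → List (List ℕ)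
comps zero    zero    = [] ∷ []
comps (suc n) zero    = []
comps n       (suc k) =
  concatMap (λ a → map (λ c → suc a ∷ c) (comps (n ∸ suc a) k)) (upTo n)

-- truncated multiple zeta value:
-- zetaTr B (a₁,…,a_k) = Σ_{B ≥ n₁ > n₂ > ⋯ > n_k ≥ 1} n₁^{-a₁} ⋯ n_k^{-a_k}
zetaTr : ℕ → List ℕ → ℚ
zetaTr B []       = 1ℚ
zetaTr B (a ∷ as) = sumBetween 0 B (λ t → invPow t a * zetaTr (t ∸ 1) as)

sumList : List ℚ → ℚ
sumList []       = 0ℚ
sumList (x ∷ xs) = x + sumList xs

admissible : List ℕ → Bool
admissible []      = false
admissible (a ∷ _) = 1 <ᵇ a

firstIs2 : List ℕ → Bool
firstIs2 (2 ∷ _) = true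
firstIs2 _       = false

sumIf : (List ℕ → Bool) → (List ℕ → ℚ) → List (List ℕ) → ℚ
sumIf p f []       = 0ℚ
sumIf p f (c ∷ cs) = (if p c then f c else 0ℚ) + sumIf p f cs

-- truncations (n₁ ≤ B) of S_{n,k}, S^{[2]}_{n,k}, S^T_{n,k}
S-tr : ℕ → ℕ → ℕ → ℚ
S-tr n k B = sumIf admissible (zetaTr B) (comps n k)

S2-tr : ℕ → ℕ → ℕ → ℚ
S2-tr n k B = sumIf firstIs2 (zetaTr B) (comps n k)

ST-tr : ℕ → ℕ → ℕ → ℚ
ST-tr n k B = S-tr n k B - S2-tr n k B

-- M_I(1,1/2,…,1/m) = Σ_{lo < m₁ < ⋯ < m_j ≤ m} m₁^{-i₁} ⋯ m_j^{-i_j}   (lo = 0)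
Mgen : ℕ → ℕ → List ℕ → ℚ
Mgen lo m []      = 1ℚ
Mgen lo m (i ∷ I) = sumBetween lo m (λ t → invPow t i * Mgen t m I)

M-eval : List ℕ → ℕ → ℚ
M-eval I m = Mgen 0 m I

N-eval : ℕ → ℕ → ℕ → ℚ
N-eval n k m = sumList (map (λ I → M-eval I m) (comps n k))

-- truncation of η₂(u) = Σ_{m ≥ 1} u(1,…,1/m)/m² at m ≤ B
eta2-tr : (ℕ → ℚ) → ℕ → ℚ
eta2-tr u B = sumBetween 0 B (λ m → u m * invPow m 2)

-- M_I(1,…,1/m) sums over increasing indices with i₁ on the smallest, so it equals the multiple zeta
-- value ζ_m(reverse I) truncated at n₁ ≤ m. Reversal permutes the compositions of n into k parts
-- (split off the first and the last part and exchange the two sums), hence N_{n,k}(1,…,1/m) is the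
-- sum of ζ_m(I) over all compositions I of n into k parts, admissible or not. Since
-- ζ_m(a, I′) = ζ_{m-1}(a, I′) + m⁻ᵃ ζ_{m-1}(I′), summing against m⁻² over m ≤ B gives
-- ζ_B(2, a, I′) + ζ_B(a + 2, I′). Over all I the first terms make up S^{[2]}_{n+2,k+1} and the
-- second the admissible values of weight n + 2 and depth k with first argument at least 3, which is
-- S^T_{n+2,k}. So the identity holds exactly for every truncation B.
module Submission where

open import Defs
open import Data.Nat using (ℕ; _≤_; zero; suc; _∸_; _<ᵇ_; z≤n; s≤s) renaming (_+_ to _+ℕ_)
open import Data.Product using (∃-syntax; _,_)
open import Data.Rational using (ℚ; 0ℚ; _<_; _+_; _-_; ∣_∣; _*_; 1ℚ; _/_)
open import Data.Nat.Properties
  using (≤-refl; m≤n⇒m≤1+n; <⇒<ᵇ; <ᵇ⇒<; <⇒≱; <⇒≤; m∸n≤m; ∸-+-assoc)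
  renaming (+-comm to +ℕ-comm)
open import Data.Bool using (Bool; true; false; if_then_else_)
open import Data.Fin using (toℕ)
open import Data.List using (List; []; _∷_; _++_; _∷ʳ_; map; concatMap; applyUpTo; upTo; reverse)
open import Data.List.Properties using (map-cong; map-++; map-∘; unfold-reverse; reverse-involutive)
import Data.Integer as ℤ
open import Data.Rational.Properties
  using (+-identityˡ; +-identityʳ; +-assoc; +-comm; *-zeroˡ; *-zeroʳ; *-distribˡ-+; *-distribʳ-+; +-inverseʳ;
         +-0-commutativeMonoid; *-1-commutativeMonoid)
open import Data.Rational.Solver using (module +-*-Solver)
open import Algebra.Bundles using (CommutativeMonoid)
open import Algebra.Properties.CommutativeMonoid.Sum +-0-commutativeMonoid
  using (sum; sum-cong-≗; ∑-distrib-+; ∑-comm; sum-replicate-zero)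
open import Algebra.Properties.CommutativeSemigroup (CommutativeMonoid.commutativeSemigroup +-0-commutativeMonoid)
  using () renaming (interchange to +-interchange)
open import Algebra.Properties.CommutativeSemigroup (CommutativeMonoid.commutativeSemigroup *-1-commutativeMonoid)
  using () renaming (x∙yz≈y∙xz to *-left-comm)
open import Data.Empty using (⊥-elim)
open import Function using (_∘_)
open import Relation.Binary.PropositionalEquality
open ≡-Reasoning

sumTo : ℕ → (ℕ → ℚ) → ℚ
sumTo n f = sum {n} (f ∘ toℕ)

sumTo-cong : ∀ n {f g : ℕ → ℚ} → (∀ i → f i ≡ g i) → sumTo n f ≡ sumTo n g
sumTo-cong n f≗g = sum-cong-≗ {n} (f≗g ∘ toℕ)

sumTo-+ : ∀ n (f g : ℕ → ℚ) → sumTo n (λ i → f i + g i) ≡ sumTo n f + sumTo n g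
sumTo-+ n f g = ∑-distrib-+ {n} (f ∘ toℕ) (g ∘ toℕ)

sumTo-zero : ∀ n → sumTo n (λ _ → 0ℚ) ≡ 0ℚ
sumTo-zero = sum-replicate-zero

sumTo-restrict : ∀ {m n} (f : ℕ → ℚ) → m ≤ n → sumTo m f ≡ sumTo n (λ i → if i <ᵇ m then f i else 0ℚ)
sumTo-restrict {zero}  {n}     f _         = sym (sumTo-zero n)
sumTo-restrict {suc m} {suc n} f (s≤s m≤n) = cong (f 0 +_) (sumTo-restrict (f ∘ suc) m≤n)

<ᵇ-∸ : ∀ i j n → (i <ᵇ n ∸ j) ≡ (j +ℕ i <ᵇ n)
<ᵇ-∸ i zero    n       = refl
<ᵇ-∸ i (suc j) zero    = refl
<ᵇ-∸ i (suc j) (suc n) = <ᵇ-∸ i j n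

sumTo-triangle : ∀ n (F : ℕ → ℕ → ℚ) →
  sumTo n (λ a → sumTo (n ∸ suc a) (F a)) ≡ sumTo n (λ b → sumTo (n ∸ suc b) (λ a → F a b))
sumTo-triangle n F = begin
    sumTo n (λ a → sumTo (n ∸ suc a) (F a))
  ≡⟨ sumTo-cong n (λ a → sumTo-restrict (F a) (m∸n≤m n (suc a))) ⟩
    sumTo n (λ a → sumTo n (λ b → if b <ᵇ n ∸ suc a then F a b else 0ℚ))
  ≡⟨ sumTo-cong n (λ a → sumTo-cong n (λ b → cong (λ c → if c then F a b else 0ℚ) (symmetric a b))) ⟩
    sumTo n (λ a → sumTo n (λ b → if a <ᵇ n ∸ suc b then F a b else 0ℚ))
  ≡⟨ ∑-comm {n} {n} (λ a b → if toℕ a <ᵇ n ∸ suc (toℕ b) then F (toℕ a) (toℕ b) else 0ℚ) ⟩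
    sumTo n (λ b → sumTo n (λ a → if a <ᵇ n ∸ suc b then F a b else 0ℚ))
  ≡⟨ sumTo-cong n (λ b → sumTo-restrict (λ a → F a b) (m∸n≤m n (suc b))) ⟨
    sumTo n (λ b → sumTo (n ∸ suc b) (λ a → F a b))
  ∎
  where
  symmetric : ∀ a b → (b <ᵇ n ∸ suc a) ≡ (a <ᵇ n ∸ suc b)
  symmetric a b = begin
    b <ᵇ n ∸ suc a       ≡⟨ <ᵇ-∸ b (suc a) n ⟩
    suc (a +ℕ b) <ᵇ n    ≡⟨ cong (λ c → suc c <ᵇ n) (+ℕ-comm a b) ⟩
    suc (b +ℕ a) <ᵇ n    ≡⟨ <ᵇ-∸ a (suc b) n ⟨
    a <ᵇ n ∸ suc b       ∎

sumList-++ : ∀ xs ys → sumList (xs ++ ys) ≡ sumList xs + sumList ys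
sumList-++ []       ys = sym (+-identityˡ (sumList ys))
sumList-++ (x ∷ xs) ys = trans (cong (x +_) (sumList-++ xs ys)) (sym (+-assoc x (sumList xs) (sumList ys)))

module _ {A : Set} where

  sumList-map-cong : ∀ {f g : A → ℚ} → (∀ x → f x ≡ g x) → ∀ xs → sumList (map f xs) ≡ sumList (map g xs)
  sumList-map-cong f≗g xs = cong sumList (map-cong f≗g xs)

  sumList-map-zero : ∀ (xs : List A) → sumList (map (λ _ → 0ℚ) xs) ≡ 0ℚ
  sumList-map-zero []       = refl
  sumList-map-zero (x ∷ xs) = trans (cong (0ℚ +_) (sumList-map-zero xs)) (+-identityˡ 0ℚ)

  sumList-map-+ : ∀ (f g : A → ℚ) xs →
    sumList (map (λ x → f x + g x) xs) ≡ sumList (map f xs) + sumList (map g xs)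
  sumList-map-+ f g []       = sym (+-identityˡ 0ℚ)
  sumList-map-+ f g (x ∷ xs) =
    trans (cong (f x + g x +_) (sumList-map-+ f g xs)) (+-interchange (f x) (g x) _ _)

  sumList-map-*ʳ : ∀ (f : A → ℚ) c xs → sumList (map (λ x → f x * c) xs) ≡ sumList (map f xs) * c
  sumList-map-*ʳ f c []       = sym (*-zeroˡ c)
  sumList-map-*ʳ f c (x ∷ xs) =
    trans (cong (f x * c +_) (sumList-map-*ʳ f c xs)) (sym (*-distribʳ-+ c (f x) _))

  sumList-concatMap : ∀ {B : Set} (g : B → ℚ) (F : A → List B) xs →
    sumList (map g (concatMap F xs)) ≡ sumList (map (λ x → sumList (map g (F x))) xs)
  sumList-concatMap g F []       = refl
  sumList-concatMap g F (x ∷ xs) = begin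
    sumList (map g (F x ++ concatMap F xs))                  ≡⟨ cong sumList (map-++ g (F x) _) ⟩
    sumList (map g (F x) ++ map g (concatMap F xs))          ≡⟨ sumList-++ (map g (F x)) _ ⟩
    sumList (map g (F x)) + sumList (map g (concatMap F xs)) ≡⟨ cong (sumList (map g (F x)) +_) (sumList-concatMap g F xs) ⟩
    sumList (map g (F x)) + sumList (map (λ x → sumList (map g (F x))) xs) ∎

sumList-applyUpTo : ∀ (f : ℕ → ℚ) h n → sumList (map f (applyUpTo h n)) ≡ sumTo n (f ∘ h)
sumList-applyUpTo f h zero    = refl
sumList-applyUpTo f h (suc n) = cong (f (h 0) +_) (sumList-applyUpTo f (h ∘ suc) n)

if-+ : ∀ b x y → (if b then x + y else 0ℚ) ≡ (if b then x else 0ℚ) + (if b then y else 0ℚ)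
if-+ true  x y = refl
if-+ false x y = sym (+-identityˡ 0ℚ)

if-*ˡ : ∀ b c x → (if b then c * x else 0ℚ) ≡ c * (if b then x else 0ℚ)
if-*ˡ true  c x = refl
if-*ˡ false c x = sym (*-zeroʳ c)

module _ (lo : ℕ) where

  sumBetween-suc : ∀ {m} (f : ℕ → ℚ) → lo ≤ m → sumBetween lo (suc m) f ≡ sumBetween lo m f + f (suc m)
  sumBetween-suc {m} f lo≤m with lo <ᵇ suc m | <⇒<ᵇ (s≤s lo≤m)
  ... | true  | _  = refl
  ... | false | ()

  sumBetween-empty : ∀ {m} (f : ℕ → ℚ) → m ≤ lo → sumBetween lo m f ≡ 0ℚ
  sumBetween-empty {zero}  f _    = refl
  sumBetween-empty {suc m} f m<lo with lo <ᵇ suc m | <ᵇ⇒< lo (suc m)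
  ... | true  | lo<1+m = ⊥-elim (<⇒≱ (lo<1+m _) m<lo)
  ... | false | _      = trans (+-identityʳ _) (sumBetween-empty f (<⇒≤ m<lo))

  sumBetween-cong : ∀ m {f g : ℕ → ℚ} → (∀ t → t ≤ m → f t ≡ g t) → sumBetween lo m f ≡ sumBetween lo m g
  sumBetween-cong zero    f≗g = refl
  sumBetween-cong (suc m) f≗g = cong₂ _+_
    (sumBetween-cong m (λ t t≤m → f≗g t (m≤n⇒m≤1+n t≤m)))
    (cong (λ x → if lo <ᵇ suc m then x else 0ℚ) (f≗g (suc m) ≤-refl))

  sumBetween-+ : ∀ m (f g : ℕ → ℚ) →
    sumBetween lo m (λ t → f t + g t) ≡ sumBetween lo m f + sumBetween lo m g
  sumBetween-+ zero    f g = sym (+-identityˡ 0ℚ)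
  sumBetween-+ (suc m) f g =
    trans (cong₂ _+_ (sumBetween-+ m f g) (if-+ (lo <ᵇ suc m) (f (suc m)) (g (suc m))))
          (+-interchange (sumBetween lo m f) (sumBetween lo m g) _ _)

  sumBetween-*ˡ : ∀ m c (f : ℕ → ℚ) → sumBetween lo m (λ t → c * f t) ≡ c * sumBetween lo m f
  sumBetween-*ˡ zero    c f = sym (*-zeroʳ c)
  sumBetween-*ˡ (suc m) c f =
    trans (cong₂ _+_ (sumBetween-*ˡ m c f) (if-*ˡ (lo <ᵇ suc m) c (f (suc m))))
          (sym (*-distribˡ-+ c (sumBetween lo m f) _))

sumComps : (List ℕ → ℚ) → ℕ → ℕ → ℚ
sumComps g n k = sumList (map g (comps n k))

sumComps-zero-cong : ∀ {g h : List ℕ → ℚ} n → g [] ≡ h [] → sumComps g n 0 ≡ sumComps h n 0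
sumComps-zero-cong zero    g[]≡h[] = cong (_+ 0ℚ) g[]≡h[]
sumComps-zero-cong (suc n) g[]≡h[] = refl

sumComps-first : ∀ (g : List ℕ → ℚ) n k →
  sumComps g n (suc k) ≡ sumTo n (λ a → sumComps (g ∘ (suc a ∷_)) (n ∸ suc a) k)
sumComps-first g zero    k = refl
sumComps-first g (suc n) k = begin
    sumList (map g (concatMap parts (upTo (suc n))))
  ≡⟨ sumList-concatMap g parts (upTo (suc n)) ⟩
    sumList (map (λ a → sumList (map g (parts a))) (upTo (suc n)))
  ≡⟨ sumList-applyUpTo (λ a → sumList (map g (parts a))) (λ a → a) (suc n) ⟩
    sumTo (suc n) (λ a → sumList (map g (parts a)))
  ≡⟨ sumTo-cong (suc n) (λ a → cong sumList (map-∘ {g = g} {f = suc a ∷_} (comps (suc n ∸ suc a) k))) ⟨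
    sumTo (suc n) (λ a → sumComps (g ∘ (suc a ∷_)) (suc n ∸ suc a) k)
  ∎
  where
  parts : ℕ → List (List ℕ)
  parts a = map (suc a ∷_) (comps (suc n ∸ suc a) k)

sumComps-last : ∀ (g : List ℕ → ℚ) n k →
  sumComps g n (suc k) ≡ sumTo n (λ b → sumComps (g ∘ (_∷ʳ suc b)) (n ∸ suc b) k)
sumComps-last g n zero = trans (sumComps-first g n 0)
  (sumTo-cong n (λ a → sumComps-zero-cong {g ∘ (suc a ∷_)} {g ∘ (_∷ʳ suc a)} (n ∸ suc a) refl))
sumComps-last g n (suc k) = begin
    sumComps g n (suc (suc k))
  ≡⟨ sumComps-first g n (suc k) ⟩
    sumTo n (λ a → sumComps (g ∘ (suc a ∷_)) (n ∸ suc a) (suc k))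
  ≡⟨ sumTo-cong n (λ a → sumComps-last (g ∘ (suc a ∷_)) (n ∸ suc a) k) ⟩
    sumTo n (λ a → sumTo (n ∸ suc a) (λ b → inner a b (n ∸ suc a ∸ suc b)))
  ≡⟨ sumTo-triangle n (λ a b → inner a b (n ∸ suc a ∸ suc b)) ⟩
    sumTo n (λ b → sumTo (n ∸ suc b) (λ a → inner a b (n ∸ suc a ∸ suc b)))
  ≡⟨ sumTo-cong n (λ b → sumTo-cong (n ∸ suc b) (λ a → cong (inner a b) (∸-comm n (suc a) (suc b)))) ⟩
    sumTo n (λ b → sumTo (n ∸ suc b) (λ a → inner a b (n ∸ suc b ∸ suc a)))
  ≡⟨ sumTo-cong n (λ b → sumComps-first (g ∘ (_∷ʳ suc b)) (n ∸ suc b) k) ⟨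
    sumTo n (λ b → sumComps (g ∘ (_∷ʳ suc b)) (n ∸ suc b) (suc k))
  ∎
  where
  inner : ℕ → ℕ → ℕ → ℚ
  inner a b m = sumComps (λ c → g (suc a ∷ c ∷ʳ suc b)) m k

  ∸-comm : ∀ n i j → n ∸ i ∸ j ≡ n ∸ j ∸ i
  ∸-comm n i j = trans (∸-+-assoc n i j) (trans (cong (n ∸_) (+ℕ-comm i j)) (sym (∸-+-assoc n j i)))

sumComps-reverse : ∀ (g : List ℕ → ℚ) n k → sumComps (g ∘ reverse) n k ≡ sumComps g n k
sumComps-reverse g n zero    = sumComps-zero-cong n refl
sumComps-reverse g n (suc k) = begin
    sumComps (g ∘ reverse) n (suc k)
  ≡⟨ sumComps-first (g ∘ reverse) n k ⟩
    sumTo n (λ a → sumComps (g ∘ reverse ∘ (suc a ∷_)) (n ∸ suc a) k)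
  ≡⟨ sumTo-cong n (λ a → sumList-map-cong (cong g ∘ unfold-reverse (suc a)) (comps (n ∸ suc a) k)) ⟩
    sumTo n (λ a → sumComps ((g ∘ (_∷ʳ suc a)) ∘ reverse) (n ∸ suc a) k)
  ≡⟨ sumTo-cong n (λ a → sumComps-reverse (g ∘ (_∷ʳ suc a)) (n ∸ suc a) k) ⟩
    sumTo n (λ a → sumComps (g ∘ (_∷ʳ suc a)) (n ∸ suc a) k)
  ≡⟨ sumComps-last g n k ⟨
    sumComps g n (suc k)
  ∎

Mgen-∷ʳ-vanish : ∀ m I i → Mgen m m (I ∷ʳ i) ≡ 0ℚ
Mgen-∷ʳ-vanish m []      i = sumBetween-empty m _ ≤-refl
Mgen-∷ʳ-vanish m (j ∷ I) i = sumBetween-empty m _ ≤-refl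

Mgen-∷ʳ : ∀ {lo m} I i → lo ≤ m →
  Mgen lo (suc m) (I ∷ʳ i) ≡ Mgen lo m (I ∷ʳ i) + invPow (suc m) i * Mgen lo m I
Mgen-∷ʳ {lo} {m} []      i lo≤m = sumBetween-suc lo _ lo≤m
Mgen-∷ʳ {lo} {m} (j ∷ I) i lo≤m = begin
    sumBetween lo (suc m) (λ t → invPow t j * Mgen t (suc m) (I ∷ʳ i))
  ≡⟨ sumBetween-suc lo _ lo≤m ⟩
    sumBetween lo m (λ t → invPow t j * Mgen t (suc m) (I ∷ʳ i))
      + invPow (suc m) j * Mgen (suc m) (suc m) (I ∷ʳ i)
  ≡⟨ cong₂ _+_ (sumBetween-cong lo m (λ t t≤m → cong (invPow t j *_) (Mgen-∷ʳ I i t≤m)))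
               (trans (cong (invPow (suc m) j *_) (Mgen-∷ʳ-vanish (suc m) I i)) (*-zeroʳ (invPow (suc m) j))) ⟩
    sumBetween lo m (λ t → invPow t j * (Mgen t m (I ∷ʳ i) + p * Mgen t m I)) + 0ℚ
  ≡⟨ +-identityʳ _ ⟩
    sumBetween lo m (λ t → invPow t j * (Mgen t m (I ∷ʳ i) + p * Mgen t m I))
  ≡⟨ sumBetween-cong lo m (λ t _ → *-distribˡ-+ (invPow t j) _ _) ⟩
    sumBetween lo m (λ t → invPow t j * Mgen t m (I ∷ʳ i) + invPow t j * (p * Mgen t m I))
  ≡⟨ sumBetween-+ lo m _ _ ⟩
    Mgen lo m (j ∷ I ∷ʳ i) + sumBetween lo m (λ t → invPow t j * (p * Mgen t m I))
  ≡⟨ cong (Mgen lo m (j ∷ I ∷ʳ i) +_)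
       (trans (sumBetween-cong lo m (λ t _ → *-left-comm (invPow t j) p _)) (sumBetween-*ˡ lo m p _)) ⟩
    Mgen lo m (j ∷ I ∷ʳ i) + p * Mgen lo m (j ∷ I)
  ∎
  where
  p : ℚ
  p = invPow (suc m) i

Mgen-reverse : ∀ m J → Mgen 0 m (reverse J) ≡ zetaTr m J
Mgen-reverse m       []       = refl
Mgen-reverse zero    (a ∷ as) = trans (cong (Mgen 0 0) (unfold-reverse a as)) (Mgen-∷ʳ-vanish 0 (reverse as) a)
Mgen-reverse (suc m) (a ∷ as) = begin
    Mgen 0 (suc m) (reverse (a ∷ as))
  ≡⟨ cong (Mgen 0 (suc m)) (unfold-reverse a as) ⟩
    Mgen 0 (suc m) (reverse as ∷ʳ a)
  ≡⟨ Mgen-∷ʳ (reverse as) a z≤n ⟩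
    Mgen 0 m (reverse as ∷ʳ a) + invPow (suc m) a * Mgen 0 m (reverse as)
  ≡⟨ cong₂ _+_ (trans (cong (Mgen 0 m) (sym (unfold-reverse a as))) (Mgen-reverse m (a ∷ as)))
               (cong (invPow (suc m) a *_) (Mgen-reverse m as)) ⟩
    zetaTr m (a ∷ as) + invPow (suc m) a * zetaTr m as
  ∎

N-eval≡sumComps-zetaTr : ∀ n k m → N-eval n k m ≡ sumComps (zetaTr m) n k
N-eval≡sumComps-zetaTr n k m = begin
    sumComps (Mgen 0 m) n k
  ≡⟨ sumList-map-cong (λ I → trans (cong (Mgen 0 m) (sym (reverse-involutive I))) (Mgen-reverse m (reverse I)))
                      (comps n k) ⟩
    sumComps (zetaTr m ∘ reverse) n k
  ≡⟨ sumComps-reverse (zetaTr m) n k ⟩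
    sumComps (zetaTr m) n k
  ∎

eta2-tr-sumList : ∀ {A : Set} (u : A → ℕ → ℚ) xs B →
  eta2-tr (λ m → sumList (map (λ x → u x m) xs)) B ≡ sumList (map (λ x → eta2-tr (u x) B) xs)
eta2-tr-sumList u xs zero    = sym (sumList-map-zero xs)
eta2-tr-sumList u xs (suc B) = begin
    eta2-tr (λ m → sumList (map (λ x → u x m) xs)) B + sumList (map (λ x → u x (suc B)) xs) * p
  ≡⟨ cong₂ _+_ (eta2-tr-sumList u xs B) (sym (sumList-map-*ʳ (λ x → u x (suc B)) p xs)) ⟩
    sumList (map (λ x → eta2-tr (u x) B) xs) + sumList (map (λ x → u x (suc B) * p) xs)
  ≡⟨ sumList-map-+ (λ x → eta2-tr (u x) B) (λ x → u x (suc B) * p) xs ⟨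
    sumList (map (λ x → eta2-tr (u x) (suc B)) xs)
  ∎
  where
  p : ℚ
  p = invPow (suc B) 2

eta2-tr-zetaTr : ∀ B a as →
  eta2-tr (λ m → zetaTr m (a ∷ as)) B ≡ zetaTr B (2 ∷ a ∷ as) + zetaTr B (suc (suc a) ∷ as)
eta2-tr-zetaTr zero    a as = sym (+-identityˡ 0ℚ)
-- invPow (suc B) e unfolds to r * (r * ⋯) with r = 1/(B+1), so m⁻² m⁻ᵃ = m⁻⁽ᵃ⁺²⁾ is ring normalisation.
eta2-tr-zetaTr (suc B) a as =
  trans (cong (_+ zetaTr (suc B) (a ∷ as) * invPow (suc B) 2) (eta2-tr-zetaTr B a as))
        (regroup (zetaTr B (2 ∷ a ∷ as)) (zetaTr B (suc (suc a) ∷ as)) (zetaTr B (a ∷ as))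
                 (invPow (suc B) a) (zetaTr B as) (ℤ.+ 1 / suc B))
  where
  regroup : ∀ y z v q w r →
    (y + z) + (v + q * w) * (r * (r * 1ℚ)) ≡ (y + r * (r * 1ℚ) * v) + (z + r * (r * q) * w)
  regroup = solve 6 (λ y z v q w r →
    (y :+ z) :+ (v :+ q :* w) :* (r :* (r :* con 1ℚ))
      := (y :+ r :* (r :* con 1ℚ) :* v) :+ (z :+ r :* (r :* q) :* w)) refl
    where open +-*-Solver

sumIf≡sumList : ∀ (p : List ℕ → Bool) f cs → sumIf p f cs ≡ sumList (map (λ c → if p c then f c else 0ℚ) cs)
sumIf≡sumList p f []       = refl
sumIf≡sumList p f (c ∷ cs) = cong ((if p c then f c else 0ℚ) +_) (sumIf≡sumList p f cs)

sumIf-comps-first : ∀ (p : List ℕ → Bool) f n k →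
  sumIf p f (comps (suc (suc n)) (suc k))
    ≡ sumComps (λ c → if p (1 ∷ c) then f (1 ∷ c) else 0ℚ) (suc n) k
      + (sumComps (λ c → if p (2 ∷ c) then f (2 ∷ c) else 0ℚ) n k
      + sumTo n (λ a → sumComps (λ c → if p (3 +ℕ a ∷ c) then f (3 +ℕ a ∷ c) else 0ℚ) (n ∸ suc a) k))
sumIf-comps-first p f n k =
  trans (sumIf≡sumList p f (comps (suc (suc n)) (suc k))) (sumComps-first _ (suc (suc n)) k)

sumComps-zero : ∀ n k → sumComps (λ _ → 0ℚ) n k ≡ 0ℚ
sumComps-zero n k = sumList-map-zero (comps n k)

S2-tr-first : ∀ n k B → S2-tr (suc (suc n)) (suc k) B ≡ sumComps (λ c → zetaTr B (2 ∷ c)) n k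
S2-tr-first n k B = begin
    S2-tr (suc (suc n)) (suc k) B
  ≡⟨ sumIf-comps-first firstIs2 (zetaTr B) n k ⟩
    sumComps (λ _ → 0ℚ) (suc n) k + (two + sumTo n (λ a → sumComps (λ _ → 0ℚ) (n ∸ suc a) k))
  ≡⟨ cong₂ (λ x y → x + (two + y)) (sumComps-zero (suc n) k)
       (trans (sumTo-cong n (λ a → sumComps-zero (n ∸ suc a) k)) (sumTo-zero n)) ⟩
    0ℚ + (two + 0ℚ)
  ≡⟨ trans (+-identityˡ _) (+-identityʳ two) ⟩
    two
  ∎
  where
  two : ℚ
  two = sumComps (λ c → zetaTr B (2 ∷ c)) n k

ST-tr-first : ∀ n k B →
  ST-tr (suc (suc n)) (suc k) B ≡ sumTo n (λ a → sumComps (λ c → zetaTr B (3 +ℕ a ∷ c)) (n ∸ suc a) k)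
ST-tr-first n k B = begin
    S-tr (suc (suc n)) (suc k) B - S2-tr (suc (suc n)) (suc k) B
  ≡⟨ cong₂ _-_ (sumIf-comps-first admissible (zetaTr B) n k) (S2-tr-first n k B) ⟩
    (sumComps (λ _ → 0ℚ) (suc n) k + (two + rest)) - two
  ≡⟨ cong (λ x → (x + (two + rest)) - two) (sumComps-zero (suc n) k) ⟩
    (0ℚ + (two + rest)) - two
  ≡⟨ cancel two rest ⟩
    rest
  ∎
  where
  two rest : ℚ
  two  = sumComps (λ c → zetaTr B (2 ∷ c)) n k
  rest = sumTo n (λ a → sumComps (λ c → zetaTr B (3 +ℕ a ∷ c)) (n ∸ suc a) k)

  cancel : ∀ x y → (0ℚ + (x + y)) - x ≡ y
  cancel = solve 2 (λ x y → (con 0ℚ :+ (x :+ y)) :- x := y) refl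
    where open +-*-Solver

eta2-tr-N-eval-first : ∀ n k B →
  eta2-tr (N-eval n (suc k)) B
    ≡ sumComps (λ c → zetaTr B (2 ∷ c)) n (suc k)
      + sumTo n (λ a → sumComps (λ c → zetaTr B (3 +ℕ a ∷ c)) (n ∸ suc a) k)
eta2-tr-N-eval-first n k B = begin
    eta2-tr (N-eval n (suc k)) B
  ≡⟨ sumBetween-cong 0 B (λ m _ → cong (_* invPow m 2) (N-eval≡sumComps-zetaTr n (suc k) m)) ⟩
    eta2-tr (λ m → sumComps (zetaTr m) n (suc k)) B
  ≡⟨ eta2-tr-sumList (λ I m → zetaTr m I) (comps n (suc k)) B ⟩
    sumComps (λ I → eta2-tr (λ m → zetaTr m I) B) n (suc k)
  ≡⟨ sumComps-first (λ I → eta2-tr (λ m → zetaTr m I) B) n k ⟩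
    sumTo n (λ a → sumComps (λ c → eta2-tr (λ m → zetaTr m (suc a ∷ c)) B) (n ∸ suc a) k)
  ≡⟨ sumTo-cong n (λ a → trans (sumList-map-cong (eta2-tr-zetaTr B (suc a)) (comps (n ∸ suc a) k))
                                (sumList-map-+ (two a) (rest a) (comps (n ∸ suc a) k))) ⟩
    sumTo n (λ a → sumComps (two a) (n ∸ suc a) k + sumComps (rest a) (n ∸ suc a) k)
  ≡⟨ sumTo-+ n (λ a → sumComps (two a) (n ∸ suc a) k) (λ a → sumComps (rest a) (n ∸ suc a) k) ⟩
    sumTo n (λ a → sumComps (two a) (n ∸ suc a) k) + sumTo n (λ a → sumComps (rest a) (n ∸ suc a) k)
  ≡⟨ cong (_+ sumTo n (λ a → sumComps (rest a) (n ∸ suc a) k)) (sumComps-first (λ c → zetaTr B (2 ∷ c)) n k) ⟨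
    sumComps (λ c → zetaTr B (2 ∷ c)) n (suc k) + sumTo n (λ a → sumComps (rest a) (n ∸ suc a) k)
  ∎
  where
  two rest : ℕ → List ℕ → ℚ
  two  a c = zetaTr B (2 ∷ suc a ∷ c)
  rest a c = zetaTr B (3 +ℕ a ∷ c)

eta2-tr-N-eval≡ST-tr+S2-tr : ∀ n k B →
  eta2-tr (N-eval n (suc k)) B ≡ ST-tr (n +ℕ 2) (suc k) B + S2-tr (n +ℕ 2) (suc k +ℕ 1) B
eta2-tr-N-eval≡ST-tr+S2-tr n k B rewrite +ℕ-comm n 2 | +ℕ-comm k 1 = begin
    eta2-tr (N-eval n (suc k)) B
  ≡⟨ eta2-tr-N-eval-first n k B ⟩
    two + rest
  ≡⟨ +-comm two rest ⟩
    rest + two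
  ≡⟨ cong₂ _+_ (ST-tr-first n k B) (S2-tr-first n (suc k) B) ⟨
    ST-tr (suc (suc n)) (suc k) B + S2-tr (suc (suc n)) (suc (suc k)) B
  ∎
  where
  two rest : ℚ
  two  = sumComps (λ c → zetaTr B (2 ∷ c)) n (suc k)
  rest = sumTo n (λ a → sumComps (λ c → zetaTr B (3 +ℕ a ∷ c)) (n ∸ suc a) k)

proposition4p3 : (n k : ℕ) → 1 ≤ k → k ≤ n →
    (ε : ℚ) → 0ℚ < ε → ∃[ B₀ ] ((B : ℕ) → B₀ ≤ B →
      ∣ eta2-tr (N-eval n k) B - (ST-tr (n +ℕ 2) k B + S2-tr (n +ℕ 2) (k +ℕ 1) B) ∣ < ε)
-- The truncated identity is exact, so B₀ = 0 works.
proposition4p3 n (suc k) (s≤s z≤n) _ ε 0<ε = 0 , λ B _ →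
  subst (λ x → ∣ x ∣ < ε) (sym (p≡q⇒p-q≡0 (eta2-tr-N-eval≡ST-tr+S2-tr n k B))) 0<ε
  where
  p≡q⇒p-q≡0 : ∀ {p q} → p ≡ q → p - q ≡ 0ℚ
  p≡q⇒p-q≡0 {p} refl = +-inverseʳ p
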